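{- Let $G=(g_{i,j})_{i,j\ge0}$ be a Poupard matrix, i.e. an infinite matrix with nonnegative integer entries satisfying $g_{i,j+2}-2g_{i+1,j+1}+g_{i+2,j}+2g_{i,j}=0$ for all $i,j\ge0$, and let $G(x,y)=\sum_{i,j\ge0}g_{i,j}\frac{x^i}{i!}\frac{y^j}{j!}$. Then there exist formal power series $A(t),B(t)$ in one variable (with real coefficients) such that $$G(x,y)=A(x+y)\cos(\sqrt2\,y)+B(x+y)\sin(\sqrt2\,y).$$
   Context: All series are formal power series. -}

module Defs where

open import Data.Nat as ℕ using (ℕ; zero; suc; _∸_; _!)
open import Data.Nat.Properties using (_!≢0)
open import Data.Nat.Combinatorics using (_C_)
open import Data.Integer using (+_)
open import Data.Rational as ℚ using (ℚ; 0ℚ; 1ℚ)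
open import Data.Product using (_×_; _,_)
open import Data.Bool using (Bool; true; false; not; if_then_else_)
open import Relation.Binary.PropositionalEquality using (_≡_)

-- Poupard matrices: g : ℕ → ℕ → ℕ (nonnegative integer entries) with
--   g(i,j+2) - 2 g(i+1,j+1) + g(i+2,j) + 2 g(i,j) = 0,
-- written with all terms moved to nonnegative sides (an identity in ℕ).

IsPoupard : (ℕ → ℕ → ℕ) → Set
IsPoupard g = ∀ i j →
  g i (suc (suc j)) ℕ.+ g (suc (suc i)) j ℕ.+ 2 ℕ.* g i j ≡ 2 ℕ.* g (suc i) (suc j)

-- The coefficient field ℚ(√2) ⊂ ℝ: a pair (a , b) stands for a + b√2.

K : Set
K = ℚ × ℚ

infixl 6 _+K_
infixl 7 _*K_

_+K_ : K → K → K
(a , b) +K (c , d) = (a ℚ.+ c , b ℚ.+ d)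

_*K_ : K → K → K
(a , b) *K (c , d) = (a ℚ.* c ℚ.+ (+ 2 ℚ./ 1) ℚ.* b ℚ.* d , a ℚ.* d ℚ.+ b ℚ.* c)

0K 1K √2 : K
0K = (0ℚ , 0ℚ)
1K = (1ℚ , 0ℚ)
√2 = (0ℚ , 1ℚ)

fromℚ : ℚ → K
fromℚ q = (q , 0ℚ)

_^K_ : K → ℕ → K
x ^K zero = 1K
x ^K suc n = x *K (x ^K n)

sumK : ℕ → (ℕ → K) → K
sumK zero f = f 0
sumK (suc n) f = sumK n f +K f (suc n)

invFact : ℕ → ℚ
invFact n = (+ 1 ℚ./ (n !)) {{n !≢0}}

-- one variable:  f(t) = Σ f n tⁿ
PS1 : Set
PS1 = ℕ → K

-- two variables: F(x,y) = Σ F i j xⁱ yʲ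
PS2 : Set
PS2 = ℕ → ℕ → K

_*PS_ : PS2 → PS2 → PS2
(F *PS H) i j = sumK i λ p → sumK j λ q → F p q *K H (i ∸ p) (j ∸ q)

_+PS_ : PS2 → PS2 → PS2
(F +PS H) i j = F i j +K H i j

-- substitution t ↦ x + y :  A(x+y) = Σ_n a_n Σ_{i+j=n} C(n,i) xⁱ yʲ
substSum : PS1 → PS2
substSum A i j = fromℚ (+ ((i ℕ.+ j) C i) ℚ./ 1) *K A (i ℕ.+ j)

-- substitution t ↦ c·y :  f(c y) viewed as a series in x,y
substScaledY : K → PS1 → PS2
substScaledY c f zero j = (c ^K j) *K f j
substScaledY c f (suc i) j = 0K

-- cos t = Σ (-1)ᵏ t^{2k}/(2k)!,  sin t = Σ (-1)ᵏ t^{2k+1}/(2k+1)!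
-- signFloorHalf n = (-1)^⌊n/2⌋ ; isEven n decides parity of n
signFloorHalf : ℕ → ℚ
signFloorHalf zero = 1ℚ
signFloorHalf (suc zero) = 1ℚ
signFloorHalf (suc (suc n)) = ℚ.- signFloorHalf n

isEven : ℕ → Bool
isEven zero = true
isEven (suc n) = not (isEven n)

cosPS : PS1
cosPS n = if isEven n then fromℚ (signFloorHalf n ℚ.* invFact n) else 0K

sinPS : PS1
sinPS n = if isEven n then 0K else fromℚ (signFloorHalf n ℚ.* invFact n)

egf2 : (ℕ → ℕ → ℕ) → PS2
egf2 g i j = fromℚ ((+ g i j ℚ./ 1) ℚ.* invFact i ℚ.* invFact j)

module Submission where

-- Write F(i,j) = g(i,j) ∈ ℚ and let Δ be the difference operator
-- (ΔF)(i,j) = F(i,j+1) − F(i+1,j), the coefficient form of ∂_y − ∂_x acting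
-- on exponential generating functions.  Since the shift in j is Δ plus the
-- shift in i, the binomial theorem gives
--     F(i,j) = Σ_{q≤j} C(j,q) (Δ^{j−q}F)(i+q,0).
-- The Poupard recurrence says exactly Δ²F = −2F, so every power of Δ is a
-- combination Δᵏ F = e(k) F + o(k) ΔF, where e(k) = (−2)^{k/2} for even k and
-- o(k) = (−2)^{(k−1)/2} for odd k (and 0 otherwise).  Now e(k)/k! and
-- √2·o(k)/k! are the coefficients of yᵏ in cos(√2 y) and sin(√2 y), so after
-- dividing by i! j! the expansion is the coefficient of xⁱyʲ in
-- A(x+y) cos(√2 y) + B(x+y) sin(√2 y) with A(t) = Σ F(n,0) tⁿ/n! and
-- B(t) = Σ (ΔF)(n,0) tⁿ/n! / √2.

open import Defs
open import Data.Nat using (ℕ)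
open import Data.Product using (Σ; _,_)
open import Relation.Binary.PropositionalEquality using (_≡_)

open import Level using (0ℓ)
open import Data.Nat as ℕ using (zero; suc; _∸_; _!; z≤n; s≤s; NonZero)
import Data.Nat.Properties as ℕP
open import Data.Nat.DivMod using (m/n*n≡m)
open import Data.Nat.Combinatorics
  using (_C_; nCk≡n!/k![n-k]!; k>n⇒nCk≡0; nCk+nC[k+1]≡[n+1]C[k+1]; k![n∸k]!∣n!)
import Data.Integer as ℤ
import Data.Integer.Properties as ℤP
open import Data.Rational as ℚ using (ℚ; 0ℚ; 1ℚ; _+_; _*_; -_; _-_)
import Data.Rational.Properties as ℚP
open import Data.Rational.Unnormalised as ℚᵘ using (mkℚᵘ; *≡*)
import Data.Rational.Unnormalised.Properties as ℚᵘP
open import Data.Bool using (true; false; if_then_else_)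
open import Data.Bool.Properties using (not-involutive)
open import Relation.Nullary.Decidable using (dec⇒maybe)
open import Relation.Binary.PropositionalEquality
  using (refl; sym; trans; cong; cong₂; subst; module ≡-Reasoning)
open import Tactic.RingSolver using (solve-∀)
open import Tactic.RingSolver.Core.AlmostCommutativeRing
  using (AlmostCommutativeRing; fromCommutativeRing)

ℚ-ring : AlmostCommutativeRing 0ℓ 0ℓ
ℚ-ring = fromCommutativeRing ℚP.+-*-commutativeRing (λ x → dec⇒maybe (0ℚ ℚP.≟ x))

ι : ℕ → ℚ
ι n = ℤ.+ n ℚ./ 1

toℚᵘ-ι : ∀ n → ℚ.toℚᵘ (ι n) ℚᵘ.≃ mkℚᵘ (ℤ.+ n) 0
toℚᵘ-ι n = ℚP.toℚᵘ-fromℚᵘ (mkℚᵘ (ℤ.+ n) 0)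

ι-+ : ∀ m n → ι (m ℕ.+ n) ≡ ι m + ι n
ι-+ m n = ℚP.toℚᵘ-injective (begin
    ℚ.toℚᵘ (ι (m ℕ.+ n))                   ≈⟨ toℚᵘ-ι (m ℕ.+ n) ⟩
    mkℚᵘ (ℤ.+ (m ℕ.+ n)) 0                 ≈⟨ *≡* fractions ⟩
    mkℚᵘ (ℤ.+ m) 0 ℚᵘ.+ mkℚᵘ (ℤ.+ n) 0     ≈⟨ ℚᵘP.+-cong (toℚᵘ-ι m) (toℚᵘ-ι n) ⟨
    ℚ.toℚᵘ (ι m) ℚᵘ.+ ℚ.toℚᵘ (ι n)         ≈⟨ ℚP.toℚᵘ-homo-+ (ι m) (ι n) ⟨
    ℚ.toℚᵘ (ι m + ι n)                     ∎)
  where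
  open ℚᵘP.≃-Reasoning
  fractions : ℤ.+ (m ℕ.+ n) ℤ.* ℤ.1ℤ ≡ ((ℤ.+ m) ℤ.* ℤ.1ℤ ℤ.+ (ℤ.+ n) ℤ.* ℤ.1ℤ) ℤ.* ℤ.1ℤ
  fractions rewrite ℤP.*-identityʳ (ℤ.+ m) | ℤP.*-identityʳ (ℤ.+ n)
                  | ℤP.*-identityʳ (ℤ.+ m ℤ.+ ℤ.+ n) = ℤP.pos-+ m n

ι-* : ∀ m n → ι (m ℕ.* n) ≡ ι m * ι n
ι-* zero n = sym (ℚP.*-zeroˡ (ι n))
ι-* (suc m) n = begin
    ι (n ℕ.+ m ℕ.* n)   ≡⟨ ι-+ n (m ℕ.* n) ⟩
    ι n + ι (m ℕ.* n)   ≡⟨ cong (ι n +_) (ι-* m n) ⟩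
    ι n + ι m * ι n     ≡⟨ distrib (ι n) (ι m) ⟩
    (1ℚ + ι m) * ι n    ≡⟨ cong (_* ι n) (ι-+ 1 m) ⟨
    ι (suc m) * ι n     ∎
  where
  open ≡-Reasoning
  distrib : ∀ a b → a + b * a ≡ (1ℚ + b) * a
  distrib = solve-∀ ℚ-ring

1/d-inverse : ∀ d .{{_ : NonZero d}} → (ℤ.+ 1 ℚ./ d) * ι d ≡ 1ℚ
1/d-inverse (suc k) = ℚP.toℚᵘ-injective (begin
    ℚ.toℚᵘ ((ℤ.+ 1 ℚ./ suc k) * ι (suc k))           ≈⟨ ℚP.toℚᵘ-homo-* (ℤ.+ 1 ℚ./ suc k) (ι (suc k)) ⟩
    ℚ.toℚᵘ (ℤ.+ 1 ℚ./ suc k) ℚᵘ.* ℚ.toℚᵘ (ι (suc k))  ≈⟨ ℚᵘP.*-cong (ℚP.toℚᵘ-fromℚᵘ (mkℚᵘ (ℤ.+ 1) k)) (toℚᵘ-ι (suc k)) ⟩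
    mkℚᵘ (ℤ.+ 1) k ℚᵘ.* mkℚᵘ (ℤ.+ suc k) 0           ≈⟨ *≡* (ℤP.*-assoc (ℤ.+ 1) (ℤ.+ suc k) ℤ.1ℤ) ⟩
    ℚᵘ.1ℚᵘ                                           ∎)
  where open ℚᵘP.≃-Reasoning

invFact-inverse : ∀ n → invFact n * ι (n !) ≡ 1ℚ
invFact-inverse n = 1/d-inverse (n !) {{n ℕP.!≢0}}

-- In ℚ (as in any commutative ring), from x·(a·b) = c and inverses a', b', c' of a, b, c
-- one gets x·c' = a'·b'; this turns factorial identities into identities of
-- their reciprocals.
cancel-product : ∀ x a b c a' b' c' → a' * a ≡ 1ℚ → b' * b ≡ 1ℚ → c' * c ≡ 1ℚ →
                 x * (a * b) ≡ c → x * c' ≡ a' * b'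
cancel-product x a b c a' b' c' a'a b'b c'c xab = begin
    x * c'                               ≡⟨ insert-units x c' ⟩
    1ℚ * 1ℚ * (x * c')                   ≡⟨ cong₂ (λ u v → u * v * (x * c')) a'a b'b ⟨
    (a' * a) * (b' * b) * (x * c')       ≡⟨ regroup x a b c' a' b' ⟩
    (a' * b') * (x * (a * b)) * c'       ≡⟨ cong (λ z → (a' * b') * z * c') xab ⟩
    (a' * b') * c * c'                   ≡⟨ regroup' a' b' c c' ⟩
    (a' * b') * (c' * c)                 ≡⟨ cong ((a' * b') *_) c'c ⟩
    (a' * b') * 1ℚ                       ≡⟨ ℚP.*-identityʳ (a' * b') ⟩
    a' * b'                              ∎
  where
  open ≡-Reasoning
  insert-units : ∀ x c' → x * c' ≡ 1ℚ * 1ℚ * (x * c')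
  insert-units = solve-∀ ℚ-ring
  regroup : ∀ x a b c' a' b' → (a' * a) * (b' * b) * (x * c') ≡ (a' * b') * (x * (a * b)) * c'
  regroup = solve-∀ ℚ-ring
  regroup' : ∀ a' b' c c' → (a' * b') * c * c' ≡ (a' * b') * (c' * c)
  regroup' = solve-∀ ℚ-ring

binomial-factorials : ∀ {n k} → k ℕ.≤ n → ι (n C k) * (ι (k !) * ι ((n ∸ k) !)) ≡ ι (n !)
binomial-factorials {n} {k} k≤n = begin
    ι (n C k) * (ι (k !) * ι ((n ∸ k) !))   ≡⟨ cong (ι (n C k) *_) (ι-* (k !) ((n ∸ k) !)) ⟨
    ι (n C k) * ι (k ! ℕ.* (n ∸ k) !)       ≡⟨ ι-* (n C k) _ ⟨
    ι ((n C k) ℕ.* (k ! ℕ.* (n ∸ k) !))     ≡⟨ cong ι ℕ-identity ⟩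
    ι (n !)                                 ∎
  where
  open ≡-Reasoning
  ℕ-identity : (n C k) ℕ.* (k ! ℕ.* (n ∸ k) !) ≡ n !
  ℕ-identity = trans (cong (ℕ._* (k ! ℕ.* (n ∸ k) !)) (nCk≡n!/k![n-k]! k≤n))
                     (m/n*n≡m {{k ℕP.!* (n ∸ k) !≢0}} (k![n∸k]!∣n! k≤n))

binomial-invFact : ∀ {n k} → k ℕ.≤ n → ι (n C k) * invFact n ≡ invFact k * invFact (n ∸ k)
binomial-invFact {n} {k} k≤n =
  cancel-product (ι (n C k)) (ι (k !)) (ι ((n ∸ k) !)) (ι (n !))
    (invFact k) (invFact (n ∸ k)) (invFact n)
    (invFact-inverse k) (invFact-inverse (n ∸ k)) (invFact-inverse n)
    (binomial-factorials k≤n)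

-- The weights relating the coefficients of A(x+y)·φ(y) to C(j,q):
-- C(i+q,i)/((i+q)! (j−q)!) = C(j,q)/(i! j!)  for q ≤ j.
binomial-weights : ∀ i j q → q ℕ.≤ j →
  ι ((i ℕ.+ q) C i) * invFact (i ℕ.+ q) * invFact (j ∸ q) ≡ invFact i * invFact j * ι (j C q)
binomial-weights i j q q≤j = begin
    ι ((i ℕ.+ q) C i) * invFact (i ℕ.+ q) * invFact (j ∸ q)   ≡⟨ cong (_* invFact (j ∸ q)) split-i+q ⟩
    invFact i * invFact q * invFact (j ∸ q)                    ≡⟨ ℚP.*-assoc (invFact i) _ _ ⟩
    invFact i * (invFact q * invFact (j ∸ q))                  ≡⟨ cong (invFact i *_) (binomial-invFact q≤j) ⟨
    invFact i * (ι (j C q) * invFact j)                        ≡⟨ cong (invFact i *_) (ℚP.*-comm (ι (j C q)) (invFact j)) ⟩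
    invFact i * (invFact j * ι (j C q))                        ≡⟨ ℚP.*-assoc (invFact i) _ _ ⟨
    invFact i * invFact j * ι (j C q)                          ∎
  where
  open ≡-Reasoning
  split-i+q : ι ((i ℕ.+ q) C i) * invFact (i ℕ.+ q) ≡ invFact i * invFact q
  split-i+q = subst (λ r → ι ((i ℕ.+ q) C i) * invFact (i ℕ.+ q) ≡ invFact i * invFact r)
                    (ℕP.m+n∸m≡n i q) (binomial-invFact (ℕP.m≤m+n i q))

sumQ : ℕ → (ℕ → ℚ) → ℚ
sumQ zero f = f 0
sumQ (suc n) f = sumQ n f + f (suc n)

sumQ-cong : ∀ n {f h : ℕ → ℚ} → (∀ k → k ℕ.≤ n → f k ≡ h k) → sumQ n f ≡ sumQ n h
sumQ-cong zero f≡h = f≡h 0 z≤n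
sumQ-cong (suc n) f≡h =
  cong₂ _+_ (sumQ-cong n (λ k k≤n → f≡h k (ℕP.m≤n⇒m≤1+n k≤n))) (f≡h (suc n) ℕP.≤-refl)

sumQ-+ : ∀ n f h → sumQ n (λ k → f k + h k) ≡ sumQ n f + sumQ n h
sumQ-+ zero f h = refl
sumQ-+ (suc n) f h =
  trans (cong (_+ (f (suc n) + h (suc n))) (sumQ-+ n f h)) (interchange (sumQ n f) (sumQ n h) (f (suc n)) (h (suc n)))
  where
  interchange : ∀ a b c d → (a + b) + (c + d) ≡ (a + c) + (b + d)
  interchange = solve-∀ ℚ-ring

sumQ-scale : ∀ n c f → sumQ n (λ k → c * f k) ≡ c * sumQ n f
sumQ-scale zero c f = refl
sumQ-scale (suc n) c f =
  trans (cong (_+ c * f (suc n)) (sumQ-scale n c f)) (sym (ℚP.*-distribˡ-+ c (sumQ n f) (f (suc n))))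

sumQ-unshift : ∀ n f → sumQ (suc n) f ≡ f 0 + sumQ n (λ k → f (suc k))
sumQ-unshift zero f = refl
sumQ-unshift (suc n) f = trans (cong (_+ f (suc (suc n))) (sumQ-unshift n f))
                               (ℚP.+-assoc (f 0) _ (f (suc (suc n))))

sumQ-unshift-vanishing : ∀ n f → f (suc n) ≡ 0ℚ → sumQ n f ≡ f 0 + sumQ n (λ k → f (suc k))
sumQ-unshift-vanishing n f f[n+1]≡0 = begin
    sumQ n f                          ≡⟨ ℚP.+-identityʳ (sumQ n f) ⟨
    sumQ n f + 0ℚ                     ≡⟨ cong (sumQ n f +_) f[n+1]≡0 ⟨
    sumQ (suc n) f                    ≡⟨ sumQ-unshift n f ⟩
    f 0 + sumQ n (λ k → f (suc k))    ∎
  where open ≡-Reasoning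

pascal-sum : ∀ j (h : ℕ → ℚ) → sumQ (suc j) (λ q → ι (suc j C q) * h q)
                   ≡ sumQ j (λ q → ι (j C q) * h q) + sumQ j (λ q → ι (j C q) * h (suc q))
pascal-sum j h = begin
    sumQ (suc j) (λ q → ι (suc j C q) * h q)                ≡⟨ sumQ-unshift j (λ q → ι (suc j C q) * h q) ⟩
    h0 + sumQ j (λ q → ι (suc j C suc q) * h (suc q))       ≡⟨ cong (h0 +_) (sumQ-cong j pascal) ⟩
    h0 + sumQ j (λ q → L q + R q)                           ≡⟨ cong (h0 +_) (sumQ-+ j L R) ⟩
    h0 + (sumQ j L + sumQ j R)                              ≡⟨ ℚP.+-assoc h0 _ _ ⟨
    (h0 + sumQ j L) + sumQ j R                              ≡⟨ cong (_+ sumQ j R) lower ⟨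
    sumQ j (λ q → ι (j C q) * h q) + sumQ j R               ∎
  where
  open ≡-Reasoning
  h0 : ℚ
  h0 = 1ℚ * h 0
  L R : ℕ → ℚ
  L q = ι (j C suc q) * h (suc q)
  R q = ι (j C q) * h (suc q)
  pascal : ∀ q → q ℕ.≤ j → ι (suc j C suc q) * h (suc q) ≡ L q + R q
  pascal q _ = begin
      ι (suc j C suc q) * h (suc q)                     ≡⟨ cong (λ n → ι n * h (suc q)) (nCk+nC[k+1]≡[n+1]C[k+1] j q) ⟨
      ι (j C q ℕ.+ j C suc q) * h (suc q)               ≡⟨ cong (_* h (suc q)) (ι-+ (j C q) (j C suc q)) ⟩
      (ι (j C q) + ι (j C suc q)) * h (suc q)           ≡⟨ ℚP.*-distribʳ-+ (h (suc q)) (ι (j C q)) (ι (j C suc q)) ⟩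
      R q + L q                                         ≡⟨ ℚP.+-comm (R q) (L q) ⟩
      L q + R q                                         ∎
  lower : sumQ j (λ q → ι (j C q) * h q) ≡ h0 + sumQ j L
  lower = sumQ-unshift-vanishing j (λ q → ι (j C q) * h q)
            (trans (cong (λ n → ι n * h (suc j)) (k>n⇒nCk≡0 (ℕP.n<1+n j))) (ℚP.*-zeroˡ (h (suc j))))

Array : Set
Array = ℕ → ℕ → ℚ

Δ : Array → Array
Δ F i j = F i (suc j) - F (suc i) j

Δ^ : ℕ → Array → Array
Δ^ zero F = F
Δ^ (suc k) F = Δ^ k (Δ F)

-- The binomial expansion of the shift in j as (Δ + shift in i)ʲ:
--   F(i,j) = Σ_{q≤j} C(j,q) (Δ^{j−q}F)(i+q,0).
binomial-expansion : ∀ j F i → F i j ≡ sumQ j (λ q → ι (j C q) * Δ^ (j ∸ q) F (i ℕ.+ q) 0)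
binomial-expansion zero F i rewrite ℕP.+-identityʳ i = sym (ℚP.*-identityˡ (F i 0))
binomial-expansion (suc j) F i = begin
    F i (suc j)                                           ≡⟨ split (F i (suc j)) (F (suc i) j) ⟩
    Δ F i j + F (suc i) j                                 ≡⟨ cong₂ _+_ (binomial-expansion j (Δ F) i)
                                                                       (binomial-expansion j F (suc i)) ⟩
    sumQ j (λ q → ι (j C q) * Δ^ (j ∸ q) (Δ F) (i ℕ.+ q) 0)
      + sumQ j (λ q → ι (j C q) * Δ^ (j ∸ q) F (suc i ℕ.+ q) 0)
                                                          ≡⟨ cong₂ _+_ (sumQ-cong j lower-index) (sumQ-cong j upper-index) ⟩
    sumQ j (λ q → ι (j C q) * h q) + sumQ j (λ q → ι (j C q) * h (suc q))
                                                          ≡⟨ pascal-sum j h ⟨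
    sumQ (suc j) (λ q → ι (suc j C q) * h q)              ∎
  where
  open ≡-Reasoning
  split : ∀ a b → a ≡ (a - b) + b
  split = solve-∀ ℚ-ring
  h : ℕ → ℚ
  h q = Δ^ (suc j ∸ q) F (i ℕ.+ q) 0
  lower-index : ∀ q → q ℕ.≤ j → ι (j C q) * Δ^ (j ∸ q) (Δ F) (i ℕ.+ q) 0 ≡ ι (j C q) * h q
  lower-index q q≤j rewrite ℕP.+-∸-assoc 1 q≤j = refl
  upper-index : ∀ q → q ℕ.≤ j → ι (j C q) * Δ^ (j ∸ q) F (suc i ℕ.+ q) 0 ≡ ι (j C q) * h (suc q)
  upper-index q _ rewrite ℕP.+-suc i q = refl

Δ^-cong : ∀ k {F H : Array} → (∀ i j → F i j ≡ H i j) → ∀ i j → Δ^ k F i j ≡ Δ^ k H i j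
Δ^-cong zero F≡H = F≡H
Δ^-cong (suc k) F≡H = Δ^-cong k (λ i j → cong₂ _-_ (F≡H i (suc j)) (F≡H (suc i) j))

Δ^-scale : ∀ k c F i j → Δ^ k (λ a b → c * F a b) i j ≡ c * Δ^ k F i j
Δ^-scale zero c F i j = refl
Δ^-scale (suc k) c F i j =
  trans (Δ^-cong k (λ a b → factor c (F a (suc b)) (F (suc a) b)) i j) (Δ^-scale k c (Δ F) i j)
  where
  factor : ∀ c x y → c * x - c * y ≡ c * (x - y)
  factor = solve-∀ ℚ-ring

evenPow oddPow : ℚ → ℕ → ℚ
evenPow c 0 = 1ℚ
evenPow c 1 = 0ℚ
evenPow c (suc (suc k)) = c * evenPow c k
oddPow c 0 = 0ℚ
oddPow c 1 = 1ℚ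
oddPow c (suc (suc k)) = c * oddPow c k

Δ^-of-quadratic : ∀ c F → (∀ i j → Δ (Δ F) i j ≡ c * F i j) →
                  ∀ k i j → Δ^ k F i j ≡ evenPow c k * F i j + oddPow c k * Δ F i j
Δ^-of-quadratic c F ΔΔF≡cF zero i j = only-first (F i j) (Δ F i j)
  where
  only-first : ∀ x y → x ≡ 1ℚ * x + 0ℚ * y
  only-first = solve-∀ ℚ-ring
Δ^-of-quadratic c F ΔΔF≡cF (suc zero) i j = only-second (F i j) (Δ F i j)
  where
  only-second : ∀ x y → y ≡ 0ℚ * x + 1ℚ * y
  only-second = solve-∀ ℚ-ring
Δ^-of-quadratic c F ΔΔF≡cF (suc (suc k)) i j = begin
    Δ^ k (Δ (Δ F)) i j                          ≡⟨ Δ^-cong k ΔΔF≡cF i j ⟩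
    Δ^ k (λ a b → c * F a b) i j                ≡⟨ Δ^-scale k c F i j ⟩
    c * Δ^ k F i j                              ≡⟨ cong (c *_) (Δ^-of-quadratic c F ΔΔF≡cF k i j) ⟩
    c * (evenPow c k * F i j + oddPow c k * Δ F i j)
                                                ≡⟨ distribute c (evenPow c k) (oddPow c k) (F i j) (Δ F i j) ⟩
    c * evenPow c k * F i j + c * oddPow c k * Δ F i j ∎
  where
  open ≡-Reasoning
  distribute : ∀ c e o x y → c * (e * x + o * y) ≡ c * e * x + c * o * y
  distribute = solve-∀ ℚ-ring

minus-two : ℚ
minus-two = - ι 2

poupard-ΔΔ : ∀ g → IsPoupard g → ∀ i j → Δ (Δ (λ a b → ι (g a b))) i j ≡ minus-two * ι (g i j)
poupard-ΔΔ g poupard i j = rearrange (ι a) (ι b) (ι c) (ι e) recurrence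
  where
  a = g i (suc (suc j))
  b = g (suc (suc i)) j
  c = g i j
  e = g (suc i) (suc j)
  recurrence : ι a + ι b + ι 2 * ι c ≡ ι 2 * ι e
  recurrence = begin
      ι a + ι b + ι 2 * ι c           ≡⟨ cong₂ _+_ (ι-+ a b) (ι-* 2 c) ⟨
      ι (a ℕ.+ b) + ι (2 ℕ.* c)       ≡⟨ ι-+ (a ℕ.+ b) (2 ℕ.* c) ⟨
      ι (a ℕ.+ b ℕ.+ 2 ℕ.* c)         ≡⟨ cong ι (poupard i j) ⟩
      ι (2 ℕ.* e)                     ≡⟨ ι-* 2 e ⟩
      ι 2 * ι e                       ∎
    where open ≡-Reasoning
  rearrange : ∀ a b c e → a + b + (1ℚ + 1ℚ) * c ≡ (1ℚ + 1ℚ) * e →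
              (a - e) - (e - b) ≡ (- (1ℚ + 1ℚ)) * c
  rearrange a b c e rec = begin
      (a - e) - (e - b)                       ≡⟨ expand a b c e ⟩
      (a + b + t * c) - t * e + (- t) * c     ≡⟨ cong (λ z → z - t * e + (- t) * c) rec ⟩
      t * e - t * e + (- t) * c               ≡⟨ cancel e c ⟩
      (- t) * c                               ∎
    where
    open ≡-Reasoning
    t = 1ℚ + 1ℚ
    expand : ∀ a b c e → (a - e) - (e - b) ≡ (a + b + (1ℚ + 1ℚ) * c) - (1ℚ + 1ℚ) * e + (- (1ℚ + 1ℚ)) * c
    expand = solve-∀ ℚ-ring
    cancel : ∀ e c → (1ℚ + 1ℚ) * e - (1ℚ + 1ℚ) * e + (- (1ℚ + 1ℚ)) * c ≡ (- (1ℚ + 1ℚ)) * c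
    cancel = solve-∀ ℚ-ring

poupard-expansion : ∀ g → IsPoupard g → let F = λ a b → ι (g a b) in ∀ i j →
  F i j ≡ sumQ j (λ q → ι (j C q) * (F (i ℕ.+ q) 0 * evenPow minus-two (j ∸ q)))
        + sumQ j (λ q → ι (j C q) * (Δ F (i ℕ.+ q) 0 * oddPow minus-two (j ∸ q)))
poupard-expansion g poupard i j = begin
    F i j                                          ≡⟨ binomial-expansion j F i ⟩
    sumQ j (λ q → ι (j C q) * Δ^ (j ∸ q) F (i ℕ.+ q) 0)
                                                   ≡⟨ sumQ-cong j (λ q _ → split-term q) ⟩
    sumQ j (λ q → E q + O q)                       ≡⟨ sumQ-+ j E O ⟩
    sumQ j E + sumQ j O                            ∎
  where
  open ≡-Reasoning
  F : Array
  F a b = ι (g a b)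
  E O : ℕ → ℚ
  E q = ι (j C q) * (F (i ℕ.+ q) 0 * evenPow minus-two (j ∸ q))
  O q = ι (j C q) * (Δ F (i ℕ.+ q) 0 * oddPow minus-two (j ∸ q))
  distribute : ∀ b e o x y → b * (e * x + o * y) ≡ b * (x * e) + b * (y * o)
  distribute = solve-∀ ℚ-ring
  split-term : ∀ q → ι (j C q) * Δ^ (j ∸ q) F (i ℕ.+ q) 0 ≡ E q + O q
  split-term q = trans (cong (ι (j C q) *_) (Δ^-of-quadratic minus-two F (poupard-ΔΔ g poupard) (j ∸ q) (i ℕ.+ q) 0))
                       (distribute (ι (j C q)) (evenPow minus-two (j ∸ q)) (oddPow minus-two (j ∸ q)) (F (i ℕ.+ q) 0) (Δ F (i ℕ.+ q) 0))

fromℚ-* : ∀ x y → fromℚ x *K fromℚ y ≡ fromℚ (x * y)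
fromℚ-* x y = cong₂ _,_ (real x y) (imaginary x y)
  where
  real : ∀ x y → x * y + ι 2 * 0ℚ * 0ℚ ≡ x * y
  real = solve-∀ ℚ-ring
  imaginary : ∀ x y → x * 0ℚ + 0ℚ * y ≡ 0ℚ
  imaginary = solve-∀ ℚ-ring

*K-fromℚ : ∀ a b y → (a , b) *K fromℚ y ≡ (a * y , b * y)
*K-fromℚ a b y = cong₂ _,_ (real a b y) (imaginary a b y)
  where
  real : ∀ a b y → a * y + ι 2 * b * 0ℚ ≡ a * y
  real = solve-∀ ℚ-ring
  imaginary : ∀ a b y → a * 0ℚ + b * y ≡ b * y
  imaginary = solve-∀ ℚ-ring

fromℚ-*K-assoc : ∀ x u v → (fromℚ x *K u) *K v ≡ fromℚ x *K (u *K v)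
fromℚ-*K-assoc x (a , b) (c , d) = cong₂ _,_ (real x a b c d) (imaginary x a b c d)
  where
  real : ∀ x a b c d → (x * a + ι 2 * 0ℚ * b) * c + ι 2 * (x * b + 0ℚ * a) * d
                     ≡ x * (a * c + ι 2 * b * d) + ι 2 * 0ℚ * (a * d + b * c)
  real = solve-∀ ℚ-ring
  imaginary : ∀ x a b c d → (x * a + ι 2 * 0ℚ * b) * d + (x * b + 0ℚ * a) * c
                          ≡ x * (a * d + b * c) + 0ℚ * (a * c + ι 2 * b * d)
  imaginary = solve-∀ ℚ-ring

-- (x/√2)·(√2 y) = x y, where x/√2 = (½ x)·√2.
½ : ℚ
½ = ℤ.+ 1 ℚ./ 2

divide-by-√2 : ∀ x y → (0ℚ , ½ * x) *K (0ℚ , y) ≡ fromℚ (x * y)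
divide-by-√2 x y = cong₂ _,_ real (imaginary x y)
  where
  regroup : ∀ h x y → 0ℚ * 0ℚ + (1ℚ + 1ℚ) * (h * x) * y ≡ (h * (1ℚ + 1ℚ)) * (x * y)
  regroup = solve-∀ ℚ-ring
  real : 0ℚ * 0ℚ + ι 2 * (½ * x) * y ≡ x * y
  real = trans (regroup ½ x y) (trans (cong (_* (x * y)) (1/d-inverse 2)) (ℚP.*-identityˡ (x * y)))
  imaginary : ∀ x y → 0ℚ * y + ½ * x * 0ℚ ≡ 0ℚ
  imaginary = solve-∀ ℚ-ring

√2-powers : ∀ k → √2 ^K k ≡ (evenPow (ι 2) k , oddPow (ι 2) k)
√2-powers 0 = refl
√2-powers 1 = refl
√2-powers (suc (suc k)) = trans (cong (λ z → √2 *K (√2 *K z)) (√2-powers k)) (square (evenPow (ι 2) k) (oddPow (ι 2) k))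
  where
  square : ∀ a b → √2 *K (√2 *K (a , b)) ≡ (ι 2 * a , ι 2 * b)
  square a b = cong₂ _,_ (real a b) (imaginary a b)
    where
    real : ∀ a b → 0ℚ * (0ℚ * a + ι 2 * 1ℚ * b) + ι 2 * 1ℚ * (0ℚ * b + 1ℚ * a) ≡ ι 2 * a
    real = solve-∀ ℚ-ring
    imaginary : ∀ a b → 0ℚ * (0ℚ * b + 1ℚ * a) + 1ℚ * (0ℚ * a + ι 2 * 1ℚ * b) ≡ ι 2 * b
    imaginary = solve-∀ ℚ-ring

interchange-* : ∀ a x b y → (a * x) * (b * y) ≡ (a * b) * (x * y)
interchange-* = solve-∀ ℚ-ring

evenPow-* : ∀ a b k → evenPow a k * evenPow b k ≡ evenPow (a * b) k
evenPow-* a b 0 = refl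
evenPow-* a b 1 = refl
evenPow-* a b (suc (suc k)) =
  trans (interchange-* a (evenPow a k) b (evenPow b k)) (cong ((a * b) *_) (evenPow-* a b k))

oddPow-* : ∀ a b k → oddPow a k * oddPow b k ≡ oddPow (a * b) k
oddPow-* a b 0 = refl
oddPow-* a b 1 = refl
oddPow-* a b (suc (suc k)) =
  trans (interchange-* a (oddPow a k) b (oddPow b k)) (cong ((a * b) *_) (oddPow-* a b k))

oddPow-evenPow : ∀ a b k → oddPow a k * evenPow b k ≡ 0ℚ
oddPow-evenPow a b 0 = refl
oddPow-evenPow a b 1 = refl
oddPow-evenPow a b (suc (suc k)) =
  trans (interchange-* a (oddPow a k) b (evenPow b k))
        (trans (cong ((a * b) *_) (oddPow-evenPow a b k)) (ℚP.*-zeroʳ (a * b)))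

-- The signs in Defs' cos and sin series are the parity parts of (−1)^{k/2}.
-- (The step −x = (−1)·x matches the recursion of evenPow/oddPow.)
neg-as-product : ∀ x → - x ≡ (- 1ℚ) * x
neg-as-product x = trans (cong -_ (sym (ℚP.*-identityˡ x))) (ℚP.neg-distribˡ-* 1ℚ x)

cos-sign : ∀ k → (if isEven k then signFloorHalf k else 0ℚ) ≡ evenPow (- 1ℚ) k
cos-sign 0 = refl
cos-sign 1 = refl
cos-sign (suc (suc k)) rewrite not-involutive (isEven k) =
  trans (negate-if (isEven k)) (trans (cong -_ (cos-sign k)) (neg-as-product (evenPow (- 1ℚ) k)))
  where
  negate-if : ∀ b → (if b then - signFloorHalf k else 0ℚ) ≡ - (if b then signFloorHalf k else 0ℚ)
  negate-if true = refl
  negate-if false = refl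

sin-sign : ∀ k → (if isEven k then 0ℚ else signFloorHalf k) ≡ oddPow (- 1ℚ) k
sin-sign 0 = refl
sin-sign 1 = refl
sin-sign (suc (suc k)) rewrite not-involutive (isEven k) =
  trans (negate-if (isEven k)) (trans (cong -_ (sin-sign k)) (neg-as-product (oddPow (- 1ℚ) k)))
  where
  negate-if : ∀ b → (if b then 0ℚ else - signFloorHalf k) ≡ - (if b then 0ℚ else signFloorHalf k)
  negate-if true = refl
  negate-if false = refl

cosPS-coefficient : ∀ k → cosPS k ≡ fromℚ (evenPow (- 1ℚ) k * invFact k)
cosPS-coefficient k = trans (by-parity (isEven k)) (cong (λ s → fromℚ (s * invFact k)) (cos-sign k))
  where
  by-parity : ∀ b → (if b then fromℚ (signFloorHalf k * invFact k) else 0K)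
                    ≡ fromℚ ((if b then signFloorHalf k else 0ℚ) * invFact k)
  by-parity true = refl
  by-parity false = cong fromℚ (sym (ℚP.*-zeroˡ (invFact k)))

sinPS-coefficient : ∀ k → sinPS k ≡ fromℚ (oddPow (- 1ℚ) k * invFact k)
sinPS-coefficient k = trans (by-parity (isEven k)) (cong (λ s → fromℚ (s * invFact k)) (sin-sign k))
  where
  by-parity : ∀ b → (if b then 0K else fromℚ (signFloorHalf k * invFact k))
                    ≡ fromℚ ((if b then 0ℚ else signFloorHalf k) * invFact k)
  by-parity true = cong fromℚ (sym (ℚP.*-zeroˡ (invFact k)))
  by-parity false = refl

cos√2-coefficient : ∀ k → (√2 ^K k) *K cosPS k ≡ fromℚ (evenPow minus-two k * invFact k)
cos√2-coefficient k rewrite √2-powers k | cosPS-coefficient k =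
  trans (*K-fromℚ (evenPow (ι 2) k) (oddPow (ι 2) k) (evenPow (- 1ℚ) k * invFact k))
        (cong₂ _,_ (trans (sym (ℚP.*-assoc (evenPow (ι 2) k) (evenPow (- 1ℚ) k) (invFact k)))
                          (cong (_* invFact k) (evenPow-* (ι 2) (- 1ℚ) k)))
                   (trans (sym (ℚP.*-assoc (oddPow (ι 2) k) (evenPow (- 1ℚ) k) (invFact k)))
                          (trans (cong (_* invFact k) (oddPow-evenPow (ι 2) (- 1ℚ) k)) (ℚP.*-zeroˡ (invFact k)))))

sin√2-coefficient : ∀ k → (√2 ^K k) *K sinPS k ≡ (0ℚ , oddPow minus-two k * invFact k)
sin√2-coefficient k rewrite √2-powers k | sinPS-coefficient k =
  trans (*K-fromℚ (evenPow (ι 2) k) (oddPow (ι 2) k) (oddPow (- 1ℚ) k * invFact k))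
        (cong₂ _,_ (trans (sym (ℚP.*-assoc (evenPow (ι 2) k) (oddPow (- 1ℚ) k) (invFact k)))
                          (trans (cong (_* invFact k) (evenPow-oddPow k)) (ℚP.*-zeroˡ (invFact k))))
                   (trans (sym (ℚP.*-assoc (oddPow (ι 2) k) (oddPow (- 1ℚ) k) (invFact k)))
                          (cong (_* invFact k) (oddPow-* (ι 2) (- 1ℚ) k))))
  where
  evenPow-oddPow : ∀ k → evenPow (ι 2) k * oddPow (- 1ℚ) k ≡ 0ℚ
  evenPow-oddPow k = trans (ℚP.*-comm (evenPow (ι 2) k) (oddPow (- 1ℚ) k)) (oddPow-evenPow (- 1ℚ) (ι 2) k)

0K-+K : ∀ x → 0K +K x ≡ x
0K-+K (a , b) = cong₂ _,_ (ℚP.+-identityˡ a) (ℚP.+-identityˡ b)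

*K-0K : ∀ x → x *K 0K ≡ 0K
*K-0K (a , b) = cong₂ _,_ (real a b) (imaginary a b)
  where
  real : ∀ a b → a * 0ℚ + ι 2 * b * 0ℚ ≡ 0ℚ
  real = solve-∀ ℚ-ring
  imaginary : ∀ a b → a * 0ℚ + b * 0ℚ ≡ 0ℚ
  imaginary = solve-∀ ℚ-ring

sumK-cong : ∀ n {f h : ℕ → K} → (∀ k → k ℕ.≤ n → f k ≡ h k) → sumK n f ≡ sumK n h
sumK-cong zero f≡h = f≡h 0 z≤n
sumK-cong (suc n) f≡h =
  cong₂ _+K_ (sumK-cong n (λ k k≤n → f≡h k (ℕP.m≤n⇒m≤1+n k≤n))) (f≡h (suc n) ℕP.≤-refl)

sumK-zero : ∀ n (f : ℕ → K) → (∀ k → k ℕ.≤ n → f k ≡ 0K) → sumK n f ≡ 0K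
sumK-zero zero f f≡0 = f≡0 0 z≤n
sumK-zero (suc n) f f≡0 =
  trans (cong₂ _+K_ (sumK-zero n f (λ k k≤n → f≡0 k (ℕP.m≤n⇒m≤1+n k≤n))) (f≡0 (suc n) ℕP.≤-refl))
        (0K-+K 0K)

sumK-last : ∀ n (f : ℕ → K) → (∀ k → k ℕ.< n → f k ≡ 0K) → sumK n f ≡ f n
sumK-last zero f _ = refl
sumK-last (suc n) f f≡0 =
  trans (cong (_+K f (suc n)) (sumK-zero n f (λ k k≤n → f≡0 k (s≤s k≤n)))) (0K-+K (f (suc n)))

sumK-fromℚ : ∀ n f → sumK n (λ k → fromℚ (f k)) ≡ fromℚ (sumQ n f)
sumK-fromℚ zero f = refl
sumK-fromℚ (suc n) f = cong (_+K fromℚ (f (suc n))) (sumK-fromℚ n f)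

∸-positive : ∀ {p i} → p ℕ.< i → i ∸ p ≡ suc (i ∸ suc p)
∸-positive {i = suc i} (s≤s p≤i) = ℕP.+-∸-assoc 1 p≤i

-- Multiplying by a series in y alone is a convolution in the y-index only:
-- the rows p < i meet only the vanishing x-coefficients of f(cy).
*PS-scaledY : ∀ H c f i j → (H *PS substScaledY c f) i j
                          ≡ sumK j (λ q → H i q *K ((c ^K (j ∸ q)) *K f (j ∸ q)))
*PS-scaledY H c f i j =
  trans (sumK-last i (λ p → sumK j (λ q → H p q *K substScaledY c f (i ∸ p) (j ∸ q))) earlier-row)
        (sumK-cong j (λ q _ → cong (λ u → H i q *K substScaledY c f u (j ∸ q)) (ℕP.n∸n≡0 i)))
  where
  earlier-row : ∀ p → p ℕ.< i → sumK j (λ q → H p q *K substScaledY c f (i ∸ p) (j ∸ q)) ≡ 0K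
  earlier-row p p<i = sumK-zero j _ (λ q _ →
    trans (cong (λ u → H p q *K substScaledY c f u (j ∸ q)) (∸-positive p<i)) (*K-0K (H p q)))

product-coefficient : ∀ (A : PS1) c f (a w : ℕ → ℚ) →
  (∀ n k → A n *K ((c ^K k) *K f k) ≡ fromℚ (a n * invFact n * (w k * invFact k))) →
  ∀ i j → (substSum A *PS substScaledY c f) i j
          ≡ fromℚ (invFact i * invFact j * sumQ j (λ q → ι (j C q) * (a (i ℕ.+ q) * w (j ∸ q))))
product-coefficient A c f a w factorises i j = begin
    (substSum A *PS substScaledY c f) i j                             ≡⟨ *PS-scaledY (substSum A) c f i j ⟩
    sumK j (λ q → substSum A i q *K ((c ^K (j ∸ q)) *K f (j ∸ q)))   ≡⟨ sumK-cong j (λ q _ → term q) ⟩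
    sumK j (λ q → fromℚ (T q))                                        ≡⟨ sumK-fromℚ j T ⟩
    fromℚ (sumQ j T)                                                  ≡⟨ cong fromℚ (sumQ-cong j weight) ⟩
    fromℚ (sumQ j (λ q → invFact i * invFact j * S q))                ≡⟨ cong fromℚ (sumQ-scale j (invFact i * invFact j) S) ⟩
    fromℚ (invFact i * invFact j * sumQ j S)                          ∎
  where
  open ≡-Reasoning
  T S : ℕ → ℚ
  T q = ι ((i ℕ.+ q) C i) * (a (i ℕ.+ q) * invFact (i ℕ.+ q) * (w (j ∸ q) * invFact (j ∸ q)))
  S q = ι (j C q) * (a (i ℕ.+ q) * w (j ∸ q))
  term : ∀ q → substSum A i q *K ((c ^K (j ∸ q)) *K f (j ∸ q)) ≡ fromℚ (T q)
  term q = begin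
      (fromℚ (ι ((i ℕ.+ q) C i)) *K A (i ℕ.+ q)) *K ((c ^K (j ∸ q)) *K f (j ∸ q))
                                  ≡⟨ fromℚ-*K-assoc (ι ((i ℕ.+ q) C i)) (A (i ℕ.+ q)) ((c ^K (j ∸ q)) *K f (j ∸ q)) ⟩
      fromℚ (ι ((i ℕ.+ q) C i)) *K (A (i ℕ.+ q) *K ((c ^K (j ∸ q)) *K f (j ∸ q)))
                                  ≡⟨ cong (fromℚ (ι ((i ℕ.+ q) C i)) *K_) (factorises (i ℕ.+ q) (j ∸ q)) ⟩
      fromℚ (ι ((i ℕ.+ q) C i)) *K fromℚ (a (i ℕ.+ q) * invFact (i ℕ.+ q) * (w (j ∸ q) * invFact (j ∸ q)))
                                  ≡⟨ fromℚ-* (ι ((i ℕ.+ q) C i)) (a (i ℕ.+ q) * invFact (i ℕ.+ q) * (w (j ∸ q) * invFact (j ∸ q))) ⟩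
      fromℚ (T q)                 ∎
  regroup : ∀ C a n w k → C * (a * n * (w * k)) ≡ (C * n * k) * (a * w)
  regroup = solve-∀ ℚ-ring
  weight : ∀ q → q ℕ.≤ j → T q ≡ invFact i * invFact j * S q
  weight q q≤j = begin
      T q                                                       ≡⟨ regroup (ι ((i ℕ.+ q) C i)) (a (i ℕ.+ q)) (invFact (i ℕ.+ q)) (w (j ∸ q)) (invFact (j ∸ q)) ⟩
      ι ((i ℕ.+ q) C i) * invFact (i ℕ.+ q) * invFact (j ∸ q) * (a (i ℕ.+ q) * w (j ∸ q))
                                                                ≡⟨ cong (_* (a (i ℕ.+ q) * w (j ∸ q))) (binomial-weights i j q q≤j) ⟩
      invFact i * invFact j * ι (j C q) * (a (i ℕ.+ q) * w (j ∸ q))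
                                                                ≡⟨ ℚP.*-assoc (invFact i * invFact j) (ι (j C q)) (a (i ℕ.+ q) * w (j ∸ q)) ⟩
      invFact i * invFact j * S q                               ∎

proposition9p2 : (g : ℕ → ℕ → ℕ) → IsPoupard g →
    Σ PS1 λ A → Σ PS1 λ B →
      ∀ i j → egf2 g i j ≡
        ((substSum A *PS substScaledY √2 cosPS) +PS (substSum B *PS substScaledY √2 sinPS)) i j
proposition9p2 g poupard = A , B , coefficient
  where
  F : Array
  F a b = ι (g a b)
  A B : PS1
  A n = fromℚ (F n 0 * invFact n)
  B n = (0ℚ , ½ * (Δ F n 0 * invFact n))
  cos-part : ∀ i j → (substSum A *PS substScaledY √2 cosPS) i j
    ≡ fromℚ (invFact i * invFact j * sumQ j (λ q → ι (j C q) * (F (i ℕ.+ q) 0 * evenPow minus-two (j ∸ q))))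
  cos-part = product-coefficient A √2 cosPS (λ n → F n 0) (evenPow minus-two) λ n k →
    trans (cong (A n *K_) (cos√2-coefficient k)) (fromℚ-* (F n 0 * invFact n) (evenPow minus-two k * invFact k))
  sin-part : ∀ i j → (substSum B *PS substScaledY √2 sinPS) i j
    ≡ fromℚ (invFact i * invFact j * sumQ j (λ q → ι (j C q) * (Δ F (i ℕ.+ q) 0 * oddPow minus-two (j ∸ q))))
  sin-part = product-coefficient B √2 sinPS (λ n → Δ F n 0) (oddPow minus-two) λ n k →
    trans (cong (B n *K_) (sin√2-coefficient k)) (divide-by-√2 (Δ F n 0 * invFact n) (oddPow minus-two k * invFact k))
  coefficient : ∀ i j → egf2 g i j ≡
    ((substSum A *PS substScaledY √2 cosPS) +PS (substSum B *PS substScaledY √2 sinPS)) i j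
  coefficient i j = begin
      fromℚ (F i j * invFact i * invFact j)       ≡⟨ cong fromℚ (commute (F i j) (invFact i) (invFact j)) ⟩
      fromℚ (invFact i * invFact j * F i j)       ≡⟨ cong (λ z → fromℚ (invFact i * invFact j * z)) (poupard-expansion g poupard i j) ⟩
      fromℚ (invFact i * invFact j * (SE + SO))   ≡⟨ cong fromℚ (ℚP.*-distribˡ-+ (invFact i * invFact j) SE SO) ⟩
      fromℚ (invFact i * invFact j * SE) +K fromℚ (invFact i * invFact j * SO)
                                                  ≡⟨ cong₂ _+K_ (cos-part i j) (sin-part i j) ⟨
      ((substSum A *PS substScaledY √2 cosPS) +PS (substSum B *PS substScaledY √2 sinPS)) i j ∎
    where
    open ≡-Reasoning
    SE SO : ℚ
    SE = sumQ j (λ q → ι (j C q) * (F (i ℕ.+ q) 0 * evenPow minus-two (j ∸ q)))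
    SO = sumQ j (λ q → ι (j C q) * (Δ F (i ℕ.+ q) 0 * oddPow minus-two (j ∸ q)))
    commute : ∀ x a b → x * a * b ≡ a * b * x
    commute = solve-∀ ℚ-ring
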